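{- Let $(Y_i)_{i\ge0}$ be a lazy simple symmetric random walk and $A_k=\sum_{i=1}^k Y_i$. For all $n\ge1$, \[ \frac12\le\frac{\mathbb{P}(A_1,\dots,A_n\ge 0\mid Y_n\in\{0,-1\})}{\mathbb{P}(A_1,\dots,A_n\ge 0\mid Y_n=0)}\le 1. \]
   Context: A lazy simple symmetric random walk is $Y_0=0$, $Y_k=\sum_{i=1}^k X_i$ with $X_i$ i.i.d., $\mathbb{P}(X_i=\pm1)=1/4$, $\mathbb{P}(X_i=0)=1/2$. -}

module Defs where

open import Data.Nat using (ℕ; zero; suc)
open import Data.Integer as ℤ using (ℤ; +_; -[1+_])
open import Data.Rational as ℚ using (ℚ; 0ℚ; 1ℚ; ½; _÷_; ≢-nonZero)
open import Data.Rational.Properties using (_≟_)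
open import Data.Vec using (Vec; []; _∷_)
open import Data.List using (List; []; _∷_; map; concatMap; filter; foldr)
open import Data.Bool using (Bool; true; false; _∧_; _∨_; if_then_else_)
open import Relation.Nullary using (yes; no; does)
open import Relation.Nullary.Decidable using (T?)

data Step : Set where
  down stay up : Step

val : Step → ℤ
val down = -[1+ 0 ]
val stay = + 0
val up   = + 1

stepProb : Step → ℚ
stepProb down = ℚ.½ ℚ.* ℚ.½
stepProb stay = ℚ.½
stepProb up   = ℚ.½ ℚ.* ℚ.½

-- All 3^n increment sequences (X_1,…,X_n): the sample space for (Y_0,…,Y_n).
allPaths : (n : ℕ) → List (Vec Step n)
allPaths zero    = [] ∷ []
allPaths (suc n) = concatMap (λ s → map (s ∷_) (allPaths n)) (down ∷ stay ∷ up ∷ [])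

pathProb : ∀ {n} → Vec Step n → ℚ
pathProb []       = 1ℚ
pathProb (s ∷ xs) = stepProb s ℚ.* pathProb xs

Event : ℕ → Set
Event n = Vec Step n → Bool

P : ∀ {n} → Event n → ℚ
P {n} E = foldr ℚ._+_ 0ℚ (map pathProb (filter (λ w → T? (E w)) (allPaths n)))

-- Conditional probability P(E | B) = P(E ∩ B) / P(B)  (set to 0 when P(B) = 0,
-- which never happens for the events used below).
_÷?_ : ℚ → ℚ → ℚ
p ÷? q with q ≟ 0ℚ
... | yes _  = 0ℚ
... | no q≢0 = _÷_ p q {{≢-nonZero q≢0}}

Pcond : ∀ {n} → Event n → Event n → ℚ
Pcond E B = P (λ w → E w ∧ B w) ÷? P B

-- Y_n = X_1 + … + X_n  (final position; Y_0 = 0).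
Yfinal : ∀ {n} → Vec Step n → ℤ
Yfinal []       = + 0
Yfinal (s ∷ xs) = val s ℤ.+ Yfinal xs

-- Check A_1,…,A_n ≥ 0 where Y_k = Y_{k-1} + X_k and A_k = A_{k-1} + Y_k,
-- processed left to right with accumulators y = Y_{k-1}, a = A_{k-1}.
allAnonneg-from : ∀ {n} → ℤ → ℤ → Vec Step n → Bool
allAnonneg-from y a []       = true
allAnonneg-from y a (s ∷ xs) =
  let y' = y ℤ.+ val s
      a' = a ℤ.+ y'
  in does (+ 0 ℤ.≤? a') ∧ allAnonneg-from y' a' xs

Anonneg : ∀ {n} → Event n
Anonneg = allAnonneg-from (+ 0) (+ 0)

Yn≡0 : ∀ {n} → Event n
Yn≡0 w = does (Yfinal w ℤ.≟ + 0)

Yn∈0,-1 : ∀ {n} → Event n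
Yn∈0,-1 w = does (Yfinal w ℤ.≟ + 0) ∨ does (Yfinal w ℤ.≟ -[1+ 0 ])

ratio : ℕ → ℚ
ratio n = Pcond {n} Anonneg Yn∈0,-1 ÷? Pcond {n} Anonneg Yn≡0

module Submission where

open import Defs
open import Data.Nat using (ℕ; _≥_)
open import Data.Rational using (½; 1ℚ; _≤_)
open import Data.Product using (_×_)

open import Data.Bool using (true; false; T; _∧_; _∨_; if_then_else_)
open import Data.Bool.Properties using (T-∧)
open import Data.Empty using (⊥; ⊥-elim)
open import Data.Integer as ℤ using (ℤ; +0; +[1+_]; -[1+_])
import Data.Integer.Properties as ℤP
open import Algebra.Properties.AbelianGroup ℤP.+-0-abelianGroup using () renaming (∙-cancelˡ to ℤ+-cancelˡ)
open import Data.Integer.Tactic.RingSolver using (solve-∀)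
open import Data.List using (List; []; _∷_; _++_; map; filter; foldr)
open import Data.List.Properties using (map-++; map-∘; map-cong)
open import Data.Nat as ℕ using (zero; suc)
import Data.Nat.Properties as ℕP
open import Data.Product as Product using (_,_)
open import Data.Rational as ℚ using (ℚ; 0ℚ; _+_; _*_; _-_; -_; _<_)
import Data.Rational.Properties as ℚP
open import Data.Rational.Solver using (module +-*-Solver)
open import Data.Vec as Vec using (Vec; []; _∷_; replicate)
open import Data.Vec.Relation.Binary.Pointwise.Inductive as Pointwise using (Pointwise; []; _∷_)
open import Function using (_∘_; mk⇔; Equivalence)
open import Relation.Nullary using (Dec; yes; no; does)
open import Relation.Nullary.Decidable using (T?; does-⇔)
open import Relation.Binary.PropositionalEquality

-- Write a_j = P(A ≥ 0, Y_n = −j) and t_j = P(Y_n = −j); the ratio is (1 + a₁/a₀)/(1 + t₁/t₀).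
-- For an event E that is increasing in the steps, first-step analysis and induction on n give
--   (n − c) P(E, Y_n = c) ≤ (n + c + 1) P(E, Y_n = c + 1),
-- an inequality that is an equality for the free walk (Y_n + n is binomial). For E the whole
-- space it holds at c = −1, and at c = 0 it gives the reverse bound because Y ↦ −Y preserves the
-- law of the walk; hence t₁/t₀ = n/(n+1). The event {A_1, …, A_n ≥ 0} is increasing, so
-- a₁/a₀ ≤ n/(n+1) = t₁/t₀ ≤ 1, and the ratio lies between 1/(1 + t₁/t₀) ≥ ½ and 1.

¼ : ℚ
¼ = ½ * ½

*-pos : ∀ k {{_ : ℚ.Positive k}} {x} → 0ℚ < x → 0ℚ < k * x
*-pos k {x} 0<x = ℚP.positive⁻¹ _ {{ℚP.pos*pos⇒pos k x {{ℚ.positive 0<x}}}}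

*-nonNeg : ∀ k {{_ : ℚ.NonNegative k}} {x} → 0ℚ ≤ x → 0ℚ ≤ k * x
*-nonNeg k {x} 0≤x = ℚP.nonNegative⁻¹ _ {{ℚP.nonNeg*nonNeg⇒nonNeg k x {{ℚ.nonNegative 0≤x}}}}

pred-suc : ∀ c → c ℤ.- ℤ.1ℤ ℤ.+ ℤ.1ℤ ≡ c
pred-suc = solve-∀

suc-pred : ∀ c → c ℤ.+ ℤ.1ℤ ℤ.- ℤ.1ℤ ≡ c
suc-pred = solve-∀

-- Defined by recursion (not as c / 1) so that toℚ (+ suc n) reduces to toℚ (+ n) + 1.
toℚ : ℤ → ℚ
toℚ +0           = 0ℚ
toℚ +[1+ n ]     = toℚ (ℤ.+ n) + 1ℚ
toℚ -[1+ zero ]  = - 1ℚ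
toℚ -[1+ suc n ] = toℚ -[1+ n ] - 1ℚ

toℚ-suc : ∀ c → toℚ (c ℤ.+ ℤ.1ℤ) ≡ toℚ c + 1ℚ
toℚ-suc (ℤ.+ n)      rewrite ℕP.+-comm n 1 = refl
toℚ-suc -[1+ zero ]  = refl
toℚ-suc -[1+ suc n ] = solve 1 (λ x → x := (x :- con 1ℚ) :+ con 1ℚ) refl (toℚ -[1+ n ])
  where open +-*-Solver

toℚ-pred : ∀ c → toℚ (c ℤ.- ℤ.1ℤ) ≡ toℚ c - 1ℚ
toℚ-pred +0       = refl
toℚ-pred +[1+ n ] = solve 1 (λ x → x := (x :+ con 1ℚ) :- con 1ℚ) refl (toℚ (ℤ.+ n))
  where open +-*-Solver
toℚ-pred -[1+ n ] rewrite ℕP.+-identityʳ n = refl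

toℚ-ℕ-nonNeg : ∀ n → 0ℚ ≤ toℚ (ℤ.+ n)
toℚ-ℕ-nonNeg zero    = ℚP.≤-refl
toℚ-ℕ-nonNeg (suc n) = ℚP.+-mono-≤ (toℚ-ℕ-nonNeg n) (ℚP.nonNegative⁻¹ 1ℚ)

sumℚ : List ℚ → ℚ
sumℚ = foldr _+_ 0ℚ

sumℚ-++ : (xs ys : List ℚ) → sumℚ (xs ++ ys) ≡ sumℚ xs + sumℚ ys
sumℚ-++ []       ys = sym (ℚP.+-identityˡ _)
sumℚ-++ (x ∷ xs) ys = trans (cong (x +_) (sumℚ-++ xs ys)) (sym (ℚP.+-assoc x _ _))

module _ {A : Set} where

  sumℚ-map-*ˡ : ∀ k (f : A → ℚ) xs → sumℚ (map (λ x → k * f x) xs) ≡ k * sumℚ (map f xs)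
  sumℚ-map-*ˡ k f []       = sym (ℚP.*-zeroʳ k)
  sumℚ-map-*ˡ k f (x ∷ xs) = trans (cong (k * f x +_) (sumℚ-map-*ˡ k f xs)) (sym (ℚP.*-distribˡ-+ k _ _))

  sumℚ-map-+ : ∀ (f g : A → ℚ) xs → sumℚ (map (λ x → f x + g x) xs) ≡ sumℚ (map f xs) + sumℚ (map g xs)
  sumℚ-map-+ f g []       = refl
  sumℚ-map-+ f g (x ∷ xs) = trans (cong (f x + g x +_) (sumℚ-map-+ f g xs)) (interchange (f x) (g x) _ _)
    where
    open +-*-Solver
    interchange : ∀ a b c d → (a + b) + (c + d) ≡ (a + c) + (b + d)
    interchange = solve 4 (λ a b c d → (a :+ b) :+ (c :+ d) := (a :+ c) :+ (b :+ d)) refl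

  sumℚ-map-mono : ∀ {f g : A → ℚ} → (∀ x → f x ≤ g x) → ∀ xs → sumℚ (map f xs) ≤ sumℚ (map g xs)
  sumℚ-map-mono f≤g []       = ℚP.≤-refl
  sumℚ-map-mono f≤g (x ∷ xs) = ℚP.+-mono-≤ (f≤g x) (sumℚ-map-mono f≤g xs)

  sumℚ-map-nonNeg : ∀ {f : A → ℚ} → (∀ x → 0ℚ ≤ f x) → ∀ xs → 0ℚ ≤ sumℚ (map f xs)
  sumℚ-map-nonNeg 0≤f []       = ℚP.≤-refl
  sumℚ-map-nonNeg 0≤f (x ∷ xs) = ℚP.+-mono-≤ (0≤f x) (sumℚ-map-nonNeg 0≤f xs)

module _ {A : Set} where

  T-does⁻ : (a? : Dec A) → T (does a?) → A
  T-does⁻ (yes a) _ = a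

  T-does⁺ : (a? : Dec A) → A → T (does a?)
  T-does⁺ (yes _) _ = _
  T-does⁺ (no ¬a) a = ¬a a

pathProb-pos : ∀ {n} (w : Vec Step n) → 0ℚ < pathProb w
pathProb-pos []      = ℚP.positive⁻¹ 1ℚ
pathProb-pos (s ∷ w) = *-pos (stepProb s) {{stepProb-pos s}} (pathProb-pos w)
  where
  stepProb-pos : ∀ s → ℚ.Positive (stepProb s)
  stepProb-pos down = _
  stepProb-pos stay = _
  stepProb-pos up   = _

module _ {n : ℕ} where

  infixr 7 _∩_
  infixr 6 _∪_
  infix  4 _⊆_

  _∩_ _∪_ : Event n → Event n → Event n
  (E ∩ F) w = E w ∧ F w
  (E ∪ F) w = E w ∨ F w

  Ω : Event n
  Ω _ = true

  _⊆_ : Event n → Event n → Set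
  E ⊆ F = ∀ w → T (E w) → T (F w)

  Disjoint : Event n → Event n → Set
  Disjoint E F = ∀ w → T (E w) → T (F w) → ⊥

  Y≡ : ℤ → Event n
  Y≡ c w = does (Yfinal w ℤ.≟ c)

  Y≡-disjoint : ∀ {c d} → c ≢ d → Disjoint (Y≡ c) (Y≡ d)
  Y≡-disjoint {c} {d} c≢d w Y≡c Y≡d =
    c≢d (trans (sym (T-does⁻ (Yfinal w ℤ.≟ c) Y≡c)) (T-does⁻ (Yfinal w ℤ.≟ d) Y≡d))

  weight : Event n → Vec Step n → ℚ
  weight E w = if E w then pathProb w else 0ℚ

  P≡sum : ∀ E → P E ≡ sumℚ (map (weight E) (allPaths n))
  P≡sum E = go (allPaths n)
    where
    go : ∀ ws → sumℚ (map pathProb (filter (λ w → T? (E w)) ws)) ≡ sumℚ (map (weight E) ws)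
    go []       = refl
    go (w ∷ ws) with E w
    ... | true  = cong (pathProb w +_) (go ws)
    ... | false = trans (go ws) (sym (ℚP.+-identityˡ _))

  P-cong : ∀ {E F} → (∀ w → E w ≡ F w) → P E ≡ P F
  P-cong {E} {F} E≗F = begin
    P E                                 ≡⟨ P≡sum E ⟩
    sumℚ (map (weight E) (allPaths n))  ≡⟨ cong sumℚ (map-cong (λ w → cong (if_then _ else _) (E≗F w)) (allPaths n)) ⟩
    sumℚ (map (weight F) (allPaths n))  ≡⟨ sym (P≡sum F) ⟩
    P F                                 ∎
    where open ≡-Reasoning

  P-nonNeg : ∀ E → 0ℚ ≤ P E
  P-nonNeg E = subst (0ℚ ≤_) (sym (P≡sum E)) (sumℚ-map-nonNeg weight-nonNeg (allPaths n))
    where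
    weight-nonNeg : ∀ w → 0ℚ ≤ weight E w
    weight-nonNeg w with E w
    ... | true  = ℚP.<⇒≤ (pathProb-pos w)
    ... | false = ℚP.≤-refl

  P-mono : ∀ {E F} → E ⊆ F → P E ≤ P F
  P-mono {E} {F} E⊆F = subst₂ _≤_ (sym (P≡sum E)) (sym (P≡sum F)) (sumℚ-map-mono weight-mono (allPaths n))
    where
    weight-mono : ∀ w → weight E w ≤ weight F w
    weight-mono w with E w | F w | E⊆F w
    ... | true  | true  | _   = ℚP.≤-refl
    ... | true  | false | E→F = ⊥-elim (E→F _)
    ... | false | false | _   = ℚP.≤-refl
    ... | false | true  | _   = ℚP.<⇒≤ (pathProb-pos w)

  P-∩-∪ : ∀ E F G → Disjoint F G → P (E ∩ (F ∪ G)) ≡ P (E ∩ F) + P (E ∩ G)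
  P-∩-∪ E F G F∩G=∅ = begin
    P (E ∩ (F ∪ G))                                       ≡⟨ P≡sum (E ∩ (F ∪ G)) ⟩
    sumℚ (map (weight (E ∩ (F ∪ G))) (allPaths n))       ≡⟨ cong sumℚ (map-cong weight-split (allPaths n)) ⟩
    sumℚ (map (λ w → weight (E ∩ F) w + weight (E ∩ G) w) (allPaths n))
      ≡⟨ sumℚ-map-+ (weight (E ∩ F)) (weight (E ∩ G)) (allPaths n) ⟩
    sumℚ (map (weight (E ∩ F)) (allPaths n)) + sumℚ (map (weight (E ∩ G)) (allPaths n))
      ≡⟨ sym (cong₂ _+_ (P≡sum (E ∩ F)) (P≡sum (E ∩ G))) ⟩
    P (E ∩ F) + P (E ∩ G)                                 ∎
    where
    open ≡-Reasoning
    weight-split : ∀ w → weight (E ∩ (F ∪ G)) w ≡ weight (E ∩ F) w + weight (E ∩ G) w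
    weight-split w with E w | F w | G w | F∩G=∅ w
    ... | false | _     | _     | _  = sym (ℚP.+-identityˡ 0ℚ)
    ... | true  | true  | true  | ∅  = ⊥-elim (∅ _ _)
    ... | true  | true  | false | _  = sym (ℚP.+-identityʳ _)
    ... | true  | false | true  | _  = sym (ℚP.+-identityˡ _)
    ... | true  | false | false | _  = sym (ℚP.+-identityˡ 0ℚ)

-- First-step analysis

stepAvg : (Step → ℚ) → ℚ
stepAvg f = ¼ * f down + (½ * f stay + ¼ * f up)

stepAvg-pos : ∀ {f} → (∀ s → 0ℚ ≤ f s) → ∀ s → 0ℚ < f s → 0ℚ < stepAvg f
stepAvg-pos 0≤f down 0<f = ℚP.+-mono-<-≤ (*-pos ¼ 0<f) (ℚP.+-mono-≤ (*-nonNeg ½ (0≤f stay)) (*-nonNeg ¼ (0≤f up)))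
stepAvg-pos 0≤f stay 0<f = ℚP.+-mono-≤-< (*-nonNeg ¼ (0≤f down)) (ℚP.+-mono-<-≤ (*-pos ½ 0<f) (*-nonNeg ¼ (0≤f up)))
stepAvg-pos 0≤f up   0<f = ℚP.+-mono-≤-< (*-nonNeg ¼ (0≤f down)) (ℚP.+-mono-≤-< (*-nonNeg ½ (0≤f stay)) (*-pos ¼ 0<f))

module _ {n : ℕ} (E : Event (suc n)) where

  weight-∷ : ∀ s w → weight E (s ∷ w) ≡ stepProb s * weight (E ∘ (s ∷_)) w
  weight-∷ s w with E (s ∷ w)
  ... | true  = refl
  ... | false = sym (ℚP.*-zeroʳ (stepProb s))

  P-∷ : P E ≡ stepAvg (λ s → P (E ∘ (s ∷_)))
  P-∷ = begin
    P E                                                                   ≡⟨ P≡sum E ⟩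
    Σ (paths down ++ (paths stay ++ (paths up ++ [])))                    ≡⟨ Σ-++ (paths down) _ ⟩
    Σ (paths down) + Σ (paths stay ++ (paths up ++ []))                   ≡⟨ cong (Σ (paths down) +_) (Σ-++ (paths stay) _) ⟩
    Σ (paths down) + (Σ (paths stay) + Σ (paths up ++ []))
      ≡⟨ cong (λ x → Σ (paths down) + (Σ (paths stay) + x)) (trans (Σ-++ (paths up) []) (ℚP.+-identityʳ _)) ⟩
    Σ (paths down) + (Σ (paths stay) + Σ (paths up))
      ≡⟨ cong₂ _+_ (Σ-paths down) (cong₂ _+_ (Σ-paths stay) (Σ-paths up)) ⟩
    ¼ * P (E ∘ (down ∷_)) + (½ * P (E ∘ (stay ∷_)) + ¼ * P (E ∘ (up ∷_)))  ∎
    where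
    open ≡-Reasoning
    paths : Step → List (Vec Step (suc n))
    paths s = map (s ∷_) (allPaths n)
    Σ : List (Vec Step (suc n)) → ℚ
    Σ ws = sumℚ (map (weight E) ws)
    Σ-++ : ∀ xs ys → Σ (xs ++ ys) ≡ Σ xs + Σ ys
    Σ-++ xs ys = trans (cong sumℚ (map-++ (weight E) xs ys)) (sumℚ-++ (map (weight E) xs) (map (weight E) ys))
    Σ-paths : ∀ s → Σ (paths s) ≡ stepProb s * P (E ∘ (s ∷_))
    Σ-paths s = begin
      sumℚ (map (weight E) (map (s ∷_) (allPaths n)))                    ≡⟨ cong sumℚ (sym (map-∘ (allPaths n))) ⟩
      sumℚ (map (weight E ∘ (s ∷_)) (allPaths n))                        ≡⟨ cong sumℚ (map-cong (weight-∷ s) (allPaths n)) ⟩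
      sumℚ (map (λ w → stepProb s * weight (E ∘ (s ∷_)) w) (allPaths n))  ≡⟨ sumℚ-map-*ˡ (stepProb s) _ (allPaths n) ⟩
      stepProb s * sumℚ (map (weight (E ∘ (s ∷_))) (allPaths n))         ≡⟨ cong (stepProb s *_) (sym (P≡sum (E ∘ (s ∷_)))) ⟩
      stepProb s * P (E ∘ (s ∷_))                                        ∎

P-pos : ∀ {n} (E : Event n) (w : Vec Step n) → T (E w) → 0ℚ < P E
P-pos E []      Ew = subst (0ℚ <_) (sym (trans (P≡sum E) (ℚP.+-identityʳ _))) (weight-pos Ew)
  where
  weight-pos : T (E []) → 0ℚ < weight E []
  weight-pos Ew with E []
  ... | true = ℚP.positive⁻¹ 1ℚ
P-pos E (s ∷ w) Ew =
  subst (0ℚ <_) (sym (P-∷ E)) (stepAvg-pos (λ s → P-nonNeg (E ∘ (s ∷_))) s (P-pos (E ∘ (s ∷_)) w Ew))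

Y≡-∷ : ∀ {n} s d (w : Vec Step n) → Y≡ (val s ℤ.+ d) (s ∷ w) ≡ Y≡ d w
Y≡-∷ s d w = does-⇔ (mk⇔ (ℤ+-cancelˡ (val s) (Yfinal w) d) (cong (λ y → val s ℤ.+ y)))
  (val s ℤ.+ Yfinal w ℤ.≟ val s ℤ.+ d) (Yfinal w ℤ.≟ d)

P-∩-Y≡-∷ : ∀ {n} (E : Event (suc n)) c → P (E ∩ Y≡ c) ≡
  ¼ * P (E ∘ (down ∷_) ∩ Y≡ (c ℤ.+ ℤ.1ℤ)) + (½ * P (E ∘ (stay ∷_) ∩ Y≡ c) + ¼ * P (E ∘ (up ∷_) ∩ Y≡ (c ℤ.- ℤ.1ℤ)))
P-∩-Y≡-∷ E c = trans (P-∷ (E ∩ Y≡ c))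
  (cong₂ (λ x y → ¼ * x + y) (shift down (down-shift c))
    (cong₂ (λ x y → ½ * x + ¼ * y) (shift stay (ℤP.+-identityˡ c)) (shift up (up-shift c))))
  where
  shift : ∀ s {d} → val s ℤ.+ d ≡ c → P ((E ∩ Y≡ c) ∘ (s ∷_)) ≡ P (E ∘ (s ∷_) ∩ Y≡ d)
  shift s {d} refl = P-cong (λ w → cong (E (s ∷ w) ∧_) (Y≡-∷ s d w))
  down-shift : ∀ c → -[1+ 0 ] ℤ.+ (c ℤ.+ ℤ.1ℤ) ≡ c
  down-shift = solve-∀
  up-shift : ∀ c → ℤ.1ℤ ℤ.+ (c ℤ.- ℤ.1ℤ) ≡ c
  up-shift = solve-∀

toℚ*P-∩-Y≡≡0 : ∀ (E : Event 0) c → toℚ c * P (E ∩ Y≡ c) ≡ 0ℚ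
toℚ*P-∩-Y≡≡0 E c = trans (cong (toℚ c *_) (P≡sum (E ∩ Y≡ c))) (vanish (E []) c)
  where
  vanish : ∀ b c → toℚ c * ((if b ∧ does (+0 ℤ.≟ c) then 1ℚ else 0ℚ) + 0ℚ) ≡ 0ℚ
  vanish false c        = ℚP.*-zeroʳ (toℚ c)
  vanish true  +0       = refl
  vanish true  +[1+ n ] = ℚP.*-zeroʳ (toℚ +[1+ n ])
  vanish true  -[1+ n ] = ℚP.*-zeroʳ (toℚ -[1+ n ])

-- Reflection symmetry

flipStep : Step → Step
flipStep down = up
flipStep stay = stay
flipStep up   = down

reflect : ∀ {n} → Vec Step n → Vec Step n
reflect = Vec.map flipStep

Yfinal-reflect : ∀ {n} (w : Vec Step n) → Yfinal (reflect w) ≡ ℤ.- Yfinal w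
Yfinal-reflect []      = refl
Yfinal-reflect (s ∷ w) =
  trans (cong₂ ℤ._+_ (val-flip s) (Yfinal-reflect w)) (sym (ℤP.neg-distrib-+ (val s) (Yfinal w)))
  where
  val-flip : ∀ s → val (flipStep s) ≡ ℤ.- val s
  val-flip down = refl
  val-flip stay = refl
  val-flip up   = refl

P-reflect : ∀ {n} (E : Event n) → P (E ∘ reflect) ≡ P E
P-reflect {zero}  E = P-cong {E = E ∘ reflect} {E} (λ { [] → refl })
P-reflect {suc n} E = begin
  P (E ∘ reflect)                                                         ≡⟨ P-∷ (E ∘ reflect) ⟩
  ¼ * P (E ∘ (up ∷_) ∘ reflect) + (½ * P (E ∘ (stay ∷_) ∘ reflect) + ¼ * P (E ∘ (down ∷_) ∘ reflect))
    ≡⟨ cong₂ (λ x y → ¼ * x + y) (P-reflect (E ∘ (up ∷_)))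
         (cong₂ (λ x y → ½ * x + ¼ * y) (P-reflect (E ∘ (stay ∷_))) (P-reflect (E ∘ (down ∷_)))) ⟩
  ¼ * Pu + (½ * Ps + ¼ * Pd)
    ≡⟨ solve 3 (λ u s d → con ¼ :* u :+ (con ½ :* s :+ con ¼ :* d) := con ¼ :* d :+ (con ½ :* s :+ con ¼ :* u))
         refl Pu Ps Pd ⟩
  ¼ * Pd + (½ * Ps + ¼ * Pu)                                              ≡⟨ sym (P-∷ E) ⟩
  P E                                                                     ∎
  where
  open ≡-Reasoning
  open +-*-Solver
  Pd = P (E ∘ (down ∷_))
  Ps = P (E ∘ (stay ∷_))
  Pu = P (E ∘ (up ∷_))

P-Y≡-neg : ∀ {n} c → P {n} (Y≡ (ℤ.- c)) ≡ P {n} (Y≡ c)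
P-Y≡-neg {n} c = trans (sym (P-reflect (Y≡ {n} (ℤ.- c)))) (P-cong reflected)
  where
  reflected : ∀ (w : Vec Step n) → Y≡ (ℤ.- c) (reflect w) ≡ Y≡ c w
  reflected w rewrite Yfinal-reflect w =
    does-⇔ (mk⇔ ℤP.neg-injective (cong (λ y → ℤ.- y))) (ℤ.- Yfinal w ℤ.≟ ℤ.- c) (Yfinal w ℤ.≟ c)

-- Increasing events

-- (m − a)/(m + a + 1) is P(Y_m = a + 1)/P(Y_m = a) for the free walk, as Y_m + m ~ Binomial(2m, ½).
BinRatio≤ : ℚ → ℚ → ℚ → ℚ → Set
BinRatio≤ m a x y = (m - a) * x ≤ (m + a + 1ℚ) * y

binRatio≤-zero : ∀ {a x y} → a * x ≡ 0ℚ → (a + 1ℚ) * y ≡ 0ℚ → BinRatio≤ 0ℚ a x y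
binRatio≤-zero {a} {x} {y} ax≡0 [a+1]y≡0 = ℚP.≤-reflexive (begin
  (0ℚ - a) * x       ≡⟨ solve 2 (λ a x → (con 0ℚ :- a) :* x := :- (a :* x)) refl a x ⟩
  - (a * x)          ≡⟨ cong -_ ax≡0 ⟩
  0ℚ                 ≡⟨ sym [a+1]y≡0 ⟩
  (a + 1ℚ) * y       ≡⟨ solve 2 (λ a y → (a :+ con 1ℚ) :* y := (con 0ℚ :+ a :+ con 1ℚ) :* y) refl a y ⟩
  (0ℚ + a + 1ℚ) * y  ∎)
  where
  open ≡-Reasoning
  open +-*-Solver

-- Against x₁, y₀, z₋ the weight m + 1 − a exceeds the inductive weights m − (a + 1), m − a,
-- m − (a − 1) by 2, 1, 0; after the factors ¼, ½, ¼ the surplus ½x₁ + ½y₀ is absorbed by x₁ ≤ y₁ and y₀ ≤ z₀.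
binRatio≤-step : ∀ {m a x₁ x₂ y₀ y₁ z₋ z₀} →
  BinRatio≤ m (a + 1ℚ) x₁ x₂ → BinRatio≤ m a y₀ y₁ → BinRatio≤ m (a - 1ℚ) z₋ z₀ →
  x₁ ≤ y₁ → y₀ ≤ z₀ →
  BinRatio≤ (m + 1ℚ) a (¼ * x₁ + (½ * y₀ + ¼ * z₋)) (¼ * x₂ + (½ * y₁ + ¼ * z₀))
binRatio≤-step {m} {a} {x₁} {x₂} {y₀} {y₁} {z₋} {z₀} hx hy hz x₁≤y₁ y₀≤z₀ = begin
  (m + 1ℚ - a) * (¼ * x₁ + (½ * y₀ + ¼ * z₋))
    ≡⟨ solve 5 (λ m a x₁ y₀ z₋ →
         (m :+ con 1ℚ :- a) :* (con ¼ :* x₁ :+ (con ½ :* y₀ :+ con ¼ :* z₋)) :=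
         con ¼ :* ((m :- (a :+ con 1ℚ)) :* x₁) :+ con ½ :* ((m :- a) :* y₀) :+ con ¼ :* ((m :- (a :- con 1ℚ)) :* z₋)
           :+ (con ½ :* x₁ :+ con ½ :* y₀)) refl m a x₁ y₀ z₋ ⟩
  ¼ * ((m - (a + 1ℚ)) * x₁) + ½ * ((m - a) * y₀) + ¼ * ((m - (a - 1ℚ)) * z₋) + (½ * x₁ + ½ * y₀)
    ≤⟨ ℚP.+-mono-≤ (ℚP.+-mono-≤ (ℚP.+-mono-≤ (¼* hx) (½* hy)) (¼* hz)) (ℚP.+-mono-≤ (½* x₁≤y₁) (½* y₀≤z₀)) ⟩
  ¼ * ((m + (a + 1ℚ) + 1ℚ) * x₂) + ½ * ((m + a + 1ℚ) * y₁) + ¼ * ((m + (a - 1ℚ) + 1ℚ) * z₀) + (½ * y₁ + ½ * z₀)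
    ≡⟨ solve 5 (λ m a x₂ y₁ z₀ →
         con ¼ :* ((m :+ (a :+ con 1ℚ) :+ con 1ℚ) :* x₂) :+ con ½ :* ((m :+ a :+ con 1ℚ) :* y₁)
           :+ con ¼ :* ((m :+ (a :- con 1ℚ) :+ con 1ℚ) :* z₀) :+ (con ½ :* y₁ :+ con ½ :* z₀) :=
         (m :+ con 1ℚ :+ a :+ con 1ℚ) :* (con ¼ :* x₂ :+ (con ½ :* y₁ :+ con ¼ :* z₀))) refl m a x₂ y₁ z₀ ⟩
  (m + 1ℚ + a + 1ℚ) * (¼ * x₂ + (½ * y₁ + ¼ * z₀))  ∎
  where
  open ℚP.≤-Reasoning
  open +-*-Solver
  ¼* : ∀ {x y} → x ≤ y → ¼ * x ≤ ¼ * y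
  ¼* = ℚP.*-monoˡ-≤-nonNeg ¼
  ½* : ∀ {x y} → x ≤ y → ½ * x ≤ ½ * y
  ½* = ℚP.*-monoˡ-≤-nonNeg ½

_≤ˢ_ : Step → Step → Set
s ≤ˢ s′ = val s ℤ.≤ val s′

UpClosed : ∀ {n} → Event n → Set
UpClosed E = ∀ {w w′} → Pointwise _≤ˢ_ w w′ → T (E w) → T (E w′)

∩-monoˡ : ∀ {n} {E F G : Event n} → E ⊆ F → E ∩ G ⊆ F ∩ G
∩-monoˡ E⊆F w EGw = Equivalence.from T-∧ (Product.map₁ (E⊆F w) (Equivalence.to T-∧ EGw))

module _ {n : ℕ} {E : Event (suc n)} (E↑ : UpClosed E) where

  upClosed-∷ : ∀ s → UpClosed (E ∘ (s ∷_))
  upClosed-∷ s w≤w′ = E↑ (ℤP.≤-refl ∷ w≤w′)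

  upClosed-head : ∀ s s′ → s ≤ˢ s′ → E ∘ (s ∷_) ⊆ E ∘ (s′ ∷_)
  upClosed-head s s′ s≤s′ w = E↑ (s≤s′ ∷ Pointwise.refl ℤP.≤-refl)

upClosed⇒binRatio≤ : ∀ n (E : Event n) → UpClosed E → ∀ c →
  BinRatio≤ (toℚ (ℤ.+ n)) (toℚ c) (P (E ∩ Y≡ c)) (P (E ∩ Y≡ (c ℤ.+ ℤ.1ℤ)))
upClosed⇒binRatio≤ zero    E E↑ c = binRatio≤-zero {toℚ c} (toℚ*P-∩-Y≡≡0 E c)
  (trans (cong (_* P (E ∩ Y≡ (c ℤ.+ ℤ.1ℤ))) (sym (toℚ-suc c))) (toℚ*P-∩-Y≡≡0 E (c ℤ.+ ℤ.1ℤ)))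
upClosed⇒binRatio≤ (suc n) E E↑ c =
  subst₂ (BinRatio≤ (m + 1ℚ) (toℚ c)) (sym (P-∩-Y≡-∷ E c)) (sym P-∩-Y≡[c+1])
    (binRatio≤-step {m} {toℚ c} hdown (IH stay c) hup down≤stay stay≤up)
  where
  m = toℚ (ℤ.+ n)
  N : Step → ℤ → ℚ
  N s d = P (E ∘ (s ∷_) ∩ Y≡ d)
  IH : ∀ s c → BinRatio≤ m (toℚ c) (N s c) (N s (c ℤ.+ ℤ.1ℤ))
  IH s = upClosed⇒binRatio≤ n (E ∘ (s ∷_)) (upClosed-∷ E↑ s)
  hdown : BinRatio≤ m (toℚ c + 1ℚ) (N down (c ℤ.+ ℤ.1ℤ)) (N down (c ℤ.+ ℤ.1ℤ ℤ.+ ℤ.1ℤ))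
  hdown = subst (λ a → BinRatio≤ m a (N down (c ℤ.+ ℤ.1ℤ)) (N down (c ℤ.+ ℤ.1ℤ ℤ.+ ℤ.1ℤ)))
            (toℚ-suc c) (IH down (c ℤ.+ ℤ.1ℤ))
  hup : BinRatio≤ m (toℚ c - 1ℚ) (N up (c ℤ.- ℤ.1ℤ)) (N up c)
  hup = subst₂ (λ a d → BinRatio≤ m a (N up (c ℤ.- ℤ.1ℤ)) (N up d))
          (toℚ-pred c) (pred-suc c) (IH up (c ℤ.- ℤ.1ℤ))
  down≤stay : N down (c ℤ.+ ℤ.1ℤ) ≤ N stay (c ℤ.+ ℤ.1ℤ)
  down≤stay = P-mono (∩-monoˡ (upClosed-head E↑ down stay ℤ.-≤+))
  stay≤up : N stay c ≤ N up c
  stay≤up = P-mono (∩-monoˡ (upClosed-head E↑ stay up (ℤ.+≤+ ℕ.z≤n)))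
  P-∩-Y≡[c+1] : P (E ∩ Y≡ (c ℤ.+ ℤ.1ℤ)) ≡ ¼ * N down (c ℤ.+ ℤ.1ℤ ℤ.+ ℤ.1ℤ) + (½ * N stay (c ℤ.+ ℤ.1ℤ) + ¼ * N up c)
  P-∩-Y≡[c+1] = trans (P-∩-Y≡-∷ E (c ℤ.+ ℤ.1ℤ))
    (cong (λ d → ¼ * N down (c ℤ.+ ℤ.1ℤ ℤ.+ ℤ.1ℤ) + (½ * N stay (c ℤ.+ ℤ.1ℤ) + ¼ * N up d)) (suc-pred c))

allAnonneg-from-mono : ∀ {n y y′ a a′} {w w′ : Vec Step n} → y ℤ.≤ y′ → a ℤ.≤ a′ → Pointwise _≤ˢ_ w w′ →
  T (allAnonneg-from y a w) → T (allAnonneg-from y′ a′ w′)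
allAnonneg-from-mono y≤y′ a≤a′ [] _ = _
allAnonneg-from-mono {y = y} {y′} {a} {a′} y≤y′ a≤a′ (_∷_ {x = s} {y = s′} s≤s′ w≤w′) h
  with Equivalence.to T-∧ h
... | 0≤A , rest = Equivalence.from T-∧
      ( T-does⁺ (+0 ℤ.≤? a′ ℤ.+ (y′ ℤ.+ val s′)) (ℤP.≤-trans (T-does⁻ (+0 ℤ.≤? a ℤ.+ (y ℤ.+ val s)) 0≤A) A≤A′)
      , allAnonneg-from-mono Y≤Y′ A≤A′ w≤w′ rest)
  where
  Y≤Y′ = ℤP.+-mono-≤ y≤y′ s≤s′
  A≤A′ = ℤP.+-mono-≤ a≤a′ Y≤Y′

Anonneg-upClosed : ∀ {n} → UpClosed (Anonneg {n})
Anonneg-upClosed = allAnonneg-from-mono ℤP.≤-refl ℤP.≤-refl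

Anonneg-stays : ∀ n → T (Anonneg (replicate n stay))
Anonneg-stays zero    = _
Anonneg-stays (suc n) = Anonneg-stays n

Y≡0-stays : ∀ n → T (Y≡ +0 (replicate n stay))
Y≡0-stays n = T-does⁺ (Yfinal (replicate n stay) ℤ.≟ +0) (Yfinal-stays n)
  where
  Yfinal-stays : ∀ n → Yfinal (replicate n stay) ≡ +0
  Yfinal-stays zero    = refl
  Yfinal-stays (suc n) = trans (ℤP.+-identityˡ _) (Yfinal-stays n)

÷?-*-cancel : ∀ p {q} → 0ℚ < q → (p ÷? q) * q ≡ p
÷?-*-cancel p {q} 0<q with q ℚP.≟ 0ℚ
... | yes q≡0 = ⊥-elim (ℚP.<-irrefl (sym q≡0) 0<q)
... | no  q≢0 = begin
  p * ℚ.1/ q * q    ≡⟨ ℚP.*-assoc p (ℚ.1/ q) q ⟩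
  p * (ℚ.1/ q * q)  ≡⟨ cong (p *_) (ℚP.*-inverseˡ q) ⟩
  p * 1ℚ            ≡⟨ ℚP.*-identityʳ p ⟩
  p                 ∎
  where
  open ≡-Reasoning
  instance _ = ℚ.≢-nonZero q≢0

≤-÷? : ∀ {k p q} → 0ℚ < q → k * q ≤ p → k ≤ p ÷? q
≤-÷? {k} {p} {q} 0<q kq≤p =
  ℚP.*-cancelʳ-≤-pos q {{ℚ.positive 0<q}} (subst (k * q ≤_) (sym (÷?-*-cancel p 0<q)) kq≤p)

÷?-≤ : ∀ {k p q} → 0ℚ < q → p ≤ k * q → p ÷? q ≤ k
÷?-≤ {k} {p} {q} 0<q p≤kq =
  ℚP.*-cancelʳ-≤-pos q {{ℚ.positive 0<q}} (subst (_≤ k * q) (sym (÷?-*-cancel p 0<q)) p≤kq)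

÷?-pos : ∀ {p q} → 0ℚ < p → 0ℚ < q → 0ℚ < p ÷? q
÷?-pos {p} {q} 0<p 0<q = ℚP.*-cancelʳ-<-nonNeg q {{ℚ.nonNegative (ℚP.<⇒≤ 0<q)}}
  (subst₂ _<_ (sym (ℚP.*-zeroˡ q)) (sym (÷?-*-cancel p 0<q)) 0<p)

condRatio : ℚ → ℚ → ℚ → ℚ → ℚ
condRatio a₀ a₁ t₀ t₁ = ((a₀ + a₁) ÷? (t₀ + t₁)) ÷? (a₀ ÷? t₀)

condRatio-bounds : ∀ {a₀ a₁ t₀ t₁} → 0ℚ < a₀ → 0ℚ ≤ a₁ → 0ℚ < t₀ → 0ℚ ≤ t₁ →
  t₁ ≤ t₀ → a₁ * t₀ ≤ a₀ * t₁ → (½ ≤ condRatio a₀ a₁ t₀ t₁) × (condRatio a₀ a₁ t₀ t₁ ≤ 1ℚ)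
condRatio-bounds {a₀} {a₁} {t₀} {t₁} 0<a₀ 0≤a₁ 0<t₀ 0≤t₁ t₁≤t₀ a₁t₀≤a₀t₁ =
  ≤-÷? 0<ρ (≤-÷? 0<t₀+t₁ lower) , ÷?-≤ 0<ρ (÷?-≤ 0<t₀+t₁ upper)
  where
  open ℚP.≤-Reasoning
  open +-*-Solver
  ρ = a₀ ÷? t₀
  0<ρ : 0ℚ < ρ
  0<ρ = ÷?-pos 0<a₀ 0<t₀
  ρt₀≡a₀ : ρ * t₀ ≡ a₀
  ρt₀≡a₀ = ÷?-*-cancel a₀ 0<t₀
  0<t₀+t₁ : 0ℚ < t₀ + t₁
  0<t₀+t₁ = ℚP.+-mono-<-≤ 0<t₀ 0≤t₁
  lower : ½ * ρ * (t₀ + t₁) ≤ a₀ + a₁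
  lower = begin
    ½ * ρ * (t₀ + t₁)  ≤⟨ ℚP.*-monoˡ-≤-nonNeg (½ * ρ) {{ℚ.nonNegative (*-nonNeg ½ (ℚP.<⇒≤ 0<ρ))}} (ℚP.+-monoʳ-≤ t₀ t₁≤t₀) ⟩
    ½ * ρ * (t₀ + t₀)  ≡⟨ solve 2 (λ ρ t → con ½ :* ρ :* (t :+ t) := ρ :* t :+ con 0ℚ) refl ρ t₀ ⟩
    ρ * t₀ + 0ℚ        ≤⟨ ℚP.+-mono-≤ (ℚP.≤-reflexive ρt₀≡a₀) 0≤a₁ ⟩
    a₀ + a₁            ∎
  a₁≤ρt₁ : a₁ ≤ ρ * t₁
  a₁≤ρt₁ = ℚP.*-cancelʳ-≤-pos t₀ {{ℚ.positive 0<t₀}} (begin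
    a₁ * t₀      ≤⟨ a₁t₀≤a₀t₁ ⟩
    a₀ * t₁      ≡⟨ cong (_* t₁) (sym ρt₀≡a₀) ⟩
    ρ * t₀ * t₁  ≡⟨ solve 3 (λ ρ t u → ρ :* t :* u := ρ :* u :* t) refl ρ t₀ t₁ ⟩
    ρ * t₁ * t₀  ∎)
  upper : a₀ + a₁ ≤ 1ℚ * ρ * (t₀ + t₁)
  upper = begin
    a₀ + a₁             ≤⟨ ℚP.+-mono-≤ (ℚP.≤-reflexive (sym ρt₀≡a₀)) a₁≤ρt₁ ⟩
    ρ * t₀ + ρ * t₁     ≡⟨ solve 3 (λ ρ t u → ρ :* t :+ ρ :* u := con 1ℚ :* ρ :* (t :+ u)) refl ρ t₀ t₁ ⟩
    1ℚ * ρ * (t₀ + t₁)  ∎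

module _ {m : ℚ} (0≤m : 0ℚ ≤ m) where

  private
    0<m+1 : 0ℚ < m + 1ℚ
    0<m+1 = ℚP.+-mono-≤-< 0≤m (ℚP.positive⁻¹ 1ℚ)

    at-−1 : ∀ {x y} → BinRatio≤ m (- 1ℚ) x y → (m + 1ℚ) * x ≤ m * y
    at-−1 {x} {y} = subst₂ _≤_ (cong (_* x) (solve 1 (λ m → m :- :- con 1ℚ := m :+ con 1ℚ) refl m))
                               (cong (_* y) (solve 1 (λ m → m :+ :- con 1ℚ :+ con 1ℚ := m) refl m))
      where open +-*-Solver

    at-0 : ∀ {x y} → BinRatio≤ m 0ℚ x y → m * x ≤ (m + 1ℚ) * y
    at-0 {x} {y} = subst₂ _≤_ (cong (_* x) (solve 1 (λ m → m :- con 0ℚ := m) refl m))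
                              (cong (_* y) (solve 1 (λ m → m :+ con 0ℚ :+ con 1ℚ := m :+ con 1ℚ) refl m))
      where open +-*-Solver

  binRatio≤-−1⇒≤ : ∀ {x y} → 0ℚ ≤ y → BinRatio≤ m (- 1ℚ) x y → x ≤ y
  binRatio≤-−1⇒≤ {x} {y} 0≤y h = ℚP.*-cancelˡ-≤-pos (m + 1ℚ) {{ℚ.positive 0<m+1}} (begin
    (m + 1ℚ) * x  ≤⟨ at-−1 h ⟩
    m * y         ≤⟨ ℚP.*-monoʳ-≤-nonNeg y {{ℚ.nonNegative 0≤y}} (ℚP.<⇒≤ m<m+1) ⟩
    (m + 1ℚ) * y  ∎)
    where
    open ℚP.≤-Reasoning
    m<m+1 : m < m + 1ℚ
    m<m+1 = subst (_< m + 1ℚ) (ℚP.+-identityʳ m) (ℚP.+-monoʳ-< m (ℚP.positive⁻¹ 1ℚ))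

  binRatio≤-cross : ∀ {a₀ a₁ t₀ t₁} → 0ℚ ≤ a₀ → 0ℚ ≤ t₀ →
    BinRatio≤ m (- 1ℚ) a₁ a₀ → BinRatio≤ m 0ℚ t₀ t₁ → a₁ * t₀ ≤ a₀ * t₁
  binRatio≤-cross {a₀} {a₁} {t₀} {t₁} 0≤a₀ 0≤t₀ ha ht = ℚP.*-cancelˡ-≤-pos (m + 1ℚ) {{ℚ.positive 0<m+1}} (begin
    (m + 1ℚ) * (a₁ * t₀)  ≡⟨ sym (ℚP.*-assoc (m + 1ℚ) a₁ t₀) ⟩
    (m + 1ℚ) * a₁ * t₀    ≤⟨ ℚP.*-monoʳ-≤-nonNeg t₀ {{ℚ.nonNegative 0≤t₀}} (at-−1 ha) ⟩
    m * a₀ * t₀           ≡⟨ solve 3 (λ m a t → m :* a :* t := a :* (m :* t)) refl m a₀ t₀ ⟩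
    a₀ * (m * t₀)         ≤⟨ ℚP.*-monoˡ-≤-nonNeg a₀ {{ℚ.nonNegative 0≤a₀}} (at-0 ht) ⟩
    a₀ * ((m + 1ℚ) * t₁)  ≡⟨ solve 3 (λ m a t → a :* (m :* t) := m :* (a :* t)) refl (m + 1ℚ) a₀ t₁ ⟩
    (m + 1ℚ) * (a₀ * t₁)  ∎)
    where
    open ℚP.≤-Reasoning
    open +-*-Solver

lemma3p6 : (n : ℕ) → n ≥ 1 → (½ ≤ ratio n) × (ratio n ≤ 1ℚ)
lemma3p6 n _ = subst (λ r → (½ ≤ r) × (r ≤ 1ℚ)) (sym ratio≡condRatio)
  (condRatio-bounds 0<a₀ (P-nonNeg {n} _) 0<t₀ (P-nonNeg {n} _)
    (binRatio≤-−1⇒≤ 0≤m (ℚP.<⇒≤ 0<t₀) ht) (binRatio≤-cross 0≤m (ℚP.<⇒≤ 0<a₀) (ℚP.<⇒≤ 0<t₀) ha ht′))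
  where
  m = toℚ (ℤ.+ n)
  0≤m = toℚ-ℕ-nonNeg n
  a t : ℤ → ℚ
  a c = P {n} (Anonneg ∩ Y≡ c)
  t c = P {n} (Ω ∩ Y≡ c)
  split : (E : Event n) → P (E ∩ (Y≡ +0 ∪ Y≡ -[1+ 0 ])) ≡ P (E ∩ Y≡ +0) + P (E ∩ Y≡ -[1+ 0 ])
  split E = P-∩-∪ E (Y≡ +0) (Y≡ -[1+ 0 ]) (Y≡-disjoint λ ())
  ratio≡condRatio : ratio n ≡ condRatio (a +0) (a -[1+ 0 ]) (t +0) (t -[1+ 0 ])
  ratio≡condRatio = cong (_÷? (a +0 ÷? t +0)) (cong₂ _÷?_ (split Anonneg) (split Ω))
  0<a₀ : 0ℚ < a +0
  0<a₀ = P-pos (Anonneg ∩ Y≡ +0) (replicate n stay) (Equivalence.from T-∧ (Anonneg-stays n , Y≡0-stays n))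
  0<t₀ : 0ℚ < t +0
  0<t₀ = P-pos (Ω ∩ Y≡ +0) (replicate n stay) (Y≡0-stays n)
  ha : BinRatio≤ m (- 1ℚ) (a -[1+ 0 ]) (a +0)
  ha = upClosed⇒binRatio≤ n Anonneg Anonneg-upClosed -[1+ 0 ]
  ht : BinRatio≤ m (- 1ℚ) (t -[1+ 0 ]) (t +0)
  ht = upClosed⇒binRatio≤ n Ω (λ _ _ → _) -[1+ 0 ]
  ht′ : BinRatio≤ m 0ℚ (t +0) (t -[1+ 0 ])
  ht′ = subst (BinRatio≤ m 0ℚ (t +0)) (sym (P-Y≡-neg {n} (ℤ.+ 1))) (upClosed⇒binRatio≤ n Ω (λ _ _ → _) +0)
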